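{- A Tamari interval $I$ is modern if and only if the bicolored blossoming tree $\Phi(I)$ is modern, i.e. has no plain edge $e=(u,v)$ such that the edge following $e$ in clockwise order around $u$ and the edge following $e$ in clockwise order around $v$ are both plain edges.
   Context: A binary tree is either a single leaf $\epsilon$ or a node with an ordered pair $(T_L,T_R)$ of binary subtrees; size = number of nodes; $\mathcal{T}_n$ = binary trees of size $n$. The Tamari order on $\mathcal{T}_n$ is the reflexive-transitive closure of right rotations $((A,B),C)\mapsto(A,(B,C))$ on subtrees; a Tamari interval is $(T,T')$ with $T\le T'$. The rise of $I=(T,T')$ is $((T,\epsilon),(\epsilon,T'))$, and $I$ is modern if its rise is a Tamari interval. Label the nodes of $T$ as $v_1,\dots,v_n$ in infix order; $a_t(T)$, $b_t(T)$ are the sizes of the right and left subtrees of $v_t$. $\phi(T,T')$ is the arc-diagram on the points $0,\tfrac12,\dots,n$ (integers black, half-integers white) with, for each $t\in[n]$, an upper arc (semicircle in upper half-plane) joining $t-\tfrac12$ to $t-1-b_t(T')$ and a lower arc (in lower half-plane) joining $t-\tfrac12$ to $t+a_t(T)$. $\gamma$ turns it into a plane tree: vertices are the black points, the two arcs at each white point form a plain edge whose upper half-edge is blue and lower half-edge red, and each black point gets two buds (edges to new leaves), one pointing left and one pointing right along the axis; the plane embedding (used for clockwise orders) is inherited from the drawing. $\Phi=\gamma\circ\phi$. -}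

module Defs where

open import Data.Nat using (ℕ; zero; suc; _+_; _∸_; _≟_)
open import Data.Product using (_×_; _,_; proj₁; proj₂; Σ; ∃; ∃-syntax)
open import Data.List using (List; []; _∷_; _++_; [_]; map; filter; upTo; downFrom)
open import Data.List.Membership.Propositional using (_∈_)
open import Relation.Binary.PropositionalEquality using (_≡_)
open import Relation.Binary.Construct.Closure.ReflexiveTransitive using (Star)
open import Relation.Nullary using (¬_)
open import Data.Sum using (_⊎_)

data BT : Set where
  leaf : BT
  node : BT → BT → BT

size : BT → ℕ
size leaf       = 0
size (node l r) = suc (size l + size r)

infixStats : BT → List (ℕ × ℕ)
infixStats leaf       = []
infixStats (node l r) = infixStats l ++ ((size l , size r) ∷ infixStats r)

-- t-th entry, 1-indexed (default (0,0) outside 1..n; only used for t ∈ [n])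
nth : List (ℕ × ℕ) → ℕ → ℕ × ℕ
nth []       _             = 0 , 0
nth (x ∷ xs) zero          = 0 , 0
nth (x ∷ xs) (suc zero)    = x
nth (x ∷ xs) (suc (suc t)) = nth xs (suc t)

b : BT → ℕ → ℕ
b T t = proj₁ (nth (infixStats T) t)

a : BT → ℕ → ℕ
a T t = proj₂ (nth (infixStats T) t)

data Rot : BT → BT → Set where
  rotate : ∀ {A B C} → Rot (node (node A B) C) (node A (node B C))
  left  : ∀ {L L' R} → Rot L L' → Rot (node L R) (node L' R)
  right : ∀ {L R R'} → Rot R R' → Rot (node L R) (node L R')

_≤T_ : BT → BT → Set
_≤T_ = Star Rot

-- A Tamari interval (T,T') is modern iff its rise ((T,ε),(ε,T')) is a
-- Tamari interval.
ModernInterval : BT → BT → Set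
ModernInterval T T' = node T leaf ≤T node leaf T'

data HalfEdge : Set where
  bud   : HalfEdge
  plain : ℕ → HalfEdge

IsPlain : HalfEdge → Set
IsPlain h = ∃[ e ] h ≡ plain e

-- A blossoming plane tree, given as a rotation system: vertices 0..nV,
-- plain edges labelled by the elements of 'edges', with endpoints 'ends',
-- and 'rotation p' the list of half-edges at p in clockwise cyclic order.
record Blossoming : Set where
  field
    nV    : ℕ
    edges : List ℕ
    ends  : ℕ → ℕ × ℕ
    rotation : ℕ → List HalfEdge

-- y immediately follows x in the cyclic list ρ
Follows : List HalfEdge → HalfEdge → HalfEdge → Set
Follows ρ x y =
  (∃[ xs ] ∃[ ys ] ρ ≡ xs ++ (x ∷ y ∷ ys)) ⊎ (∃[ xs ] ρ ≡ y ∷ (xs ++ [ x ]))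

ModernTree : Blossoming → Set
ModernTree B = ¬ (∃[ e ] e ∈ edges × Σ HalfEdge λ h₁ → Σ HalfEdge λ h₂ →
                   Follows (rotation (proj₁ (ends e))) (plain e) h₁ × IsPlain h₁ ×
                   Follows (rotation (proj₂ (ends e))) (plain e) h₂ × IsPlain h₂)
  where open Blossoming B

ascending : ℕ → List ℕ
ascending n = map suc (upTo n)

descending : ℕ → List ℕ
descending n = map suc (downFrom n)

-- black endpoint of the upper arc of white point t - 1/2 : t - 1 - b_t(T')
upEnd : BT → ℕ → ℕ
upEnd T' t = t ∸ 1 ∸ b T' t

-- black endpoint of the lower arc of white point t - 1/2 : t + a_t(T)
lowEnd : BT → ℕ → ℕ
lowEnd T t = t + a T t

-- Clockwise rotation around black point p, read off the drawing starting
-- from the left bud: left bud; upper arcs at p (which go to white points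
-- right of p), outermost (largest t) first; right bud; lower arcs at p
-- (which go to white points left of p), outermost (smallest t) first.
Φ : BT → BT → Blossoming
Φ T T' = record
  { nV    = n
  ; edges = ascending n
  ; ends  = λ t → upEnd T' t , lowEnd T t
  ; rotation = λ p → bud ∷ (map plain (filter (λ t → upEnd T' t ≟ p) (descending n))
                   ++ (bud ∷ map plain (filter (λ t → lowEnd T t ≟ p) (ascending n))))
  }
  where n = size T

module Submission where

open import Defs
open import Data.Nat hiding (_!)
open import Data.Nat.Properties
open import Data.Product using (_×_; _,_; proj₁; proj₂; Σ; ∃-syntax)
open import Data.List using (List; []; _∷_; _++_; [_]; map; filter; length)
open import Data.List.Properties using (length-++; map-++; ++-assoc; ∷-injectiveˡ)
open import Data.List.Membership.Propositional using (_∈_)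
open import Data.List.Membership.Propositional.Properties using (∈-map⁺; ∈-map⁻; ∈-filter⁺; ∈-filter⁻; ∈-upTo⁺; ∈-upTo⁻; ∈-downFrom⁺; ∈-downFrom⁻)
open import Data.List.Relation.Unary.Any using (here; there)
open import Data.List.Relation.Unary.All as All using (All)
open import Data.List.Relation.Unary.AllPairs using (AllPairs; _∷_)
import Data.List.Relation.Unary.AllPairs.Properties as AllPairs
open import Data.Sum using (_⊎_; inj₁; inj₂)
open import Function using (id)
open import Function.Bundles using (_⇔_; mk⇔)
import Function.Properties.Equivalence as ⇔
open import Relation.Nullary using (¬_; contradiction; yes; no)
open import Relation.Binary.Definitions using (Asymmetric; tri<; tri≈; tri>)
open import Relation.Binary.PropositionalEquality hiding ([_])
open import Relation.Binary.Construct.Closure.ReflexiveTransitive using (ε; _◅_; _◅◅_; gmap)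

-- Both sides are equivalent to: no node v_t has a nonempty right subtree in T and a nonempty
-- left subtree in T' (RightLeftExclusive).
--
-- Around a black point p of Φ(T,T') the plain edges are the upper arcs ending at p, by
-- decreasing t, then a bud, then the lower arcs ending at p, by increasing t. So edge t has a
-- plain successor at its upper end iff an earlier edge shares that end, which happens iff
-- b_t(T') > 0 (the left child of v_t is one); likewise at its lower end iff a_t(T) > 0.
--
-- For trees of equal size, T ≤ T' iff b_t(T) ≥ b_t(T') for all t. Hence the rise is an interval
-- iff b_t(T') ≤ b_{t+1}(T) for t < n. If a_t(T) > 0 then b_{t+1}(T) = 0, and if a_t(T) = 0 then
-- b_{t+1}(T) > b_t(T) ≥ b_t(T'); so that condition is exactly RightLeftExclusive.

+suc∸suc : ∀ k j → k + suc j ∸ suc k ≡ j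
+suc∸suc k j = trans (cong (_∸ suc k) (+-suc k j)) (m+n∸m≡n k j)

+≡+⇒∸≡∸ : ∀ x y u v → x + v ≡ y + u → x ∸ u ≡ y ∸ v
+≡+⇒∸≡∸ x y u v eq = begin
  x ∸ u             ≡⟨ [m+n]∸[m+o]≡n∸o v x u ⟨
  v + x ∸ (v + u)   ≡⟨ cong₂ _∸_ (+-comm v x) (+-comm v u) ⟩
  x + v ∸ (u + v)   ≡⟨ cong (_∸ (u + v)) eq ⟩
  y + u ∸ (u + v)   ≡⟨ cong (_∸ (u + v)) (+-comm y u) ⟩
  u + y ∸ (u + v)   ≡⟨ [m+n]∸[m+o]≡n∸o u y v ⟩
  y ∸ v             ∎
  where open ≡-Reasoning

infix 8 _!_

_!_ : List ℕ → ℕ → ℕ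
[]       ! _     = 0
(x ∷ xs) ! zero  = x
(x ∷ xs) ! suc i = xs ! i

!-++ˡ : ∀ xs ys {i} → i < length xs → (xs ++ ys) ! i ≡ xs ! i
!-++ˡ (x ∷ xs) ys {zero}  _         = refl
!-++ˡ (x ∷ xs) ys {suc i} (s≤s i<) = !-++ˡ xs ys i<

!-++ʳ : ∀ xs ys i → (xs ++ ys) ! (length xs + i) ≡ ys ! i
!-++ʳ []       ys i = refl
!-++ʳ (x ∷ xs) ys i = !-++ʳ xs ys i

!-++-∷ : ∀ xs y ys → (xs ++ y ∷ ys) ! length xs ≡ y
!-++-∷ []       y ys = refl
!-++-∷ (x ∷ xs) y ys = !-++-∷ xs y ys

!-beyond : ∀ xs {i} → length xs ≤ i → xs ! i ≡ 0
!-beyond []       _        = refl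
!-beyond (x ∷ xs) (s≤s le) = !-beyond xs le

module _ (xs : List ℕ) (y : ℕ) (ys : List ℕ) {m} (len : length xs ≡ m) where

  !-splice-< : ∀ {i} → i < m → (xs ++ y ∷ ys) ! i ≡ xs ! i
  !-splice-< i<m = !-++ˡ xs (y ∷ ys) (subst (_ <_) (sym len) i<m)

  !-splice-≡ : (xs ++ y ∷ ys) ! m ≡ y
  !-splice-≡ = subst (λ k → (xs ++ y ∷ ys) ! k ≡ y) len (!-++-∷ xs y ys)

  !-splice-> : ∀ j → (xs ++ y ∷ ys) ! (m + suc j) ≡ ys ! j
  !-splice-> j = subst (λ k → (xs ++ y ∷ ys) ! (k + suc j) ≡ ys ! j) len (!-++ʳ xs (y ∷ ys) (suc j))

data Position (m : ℕ) : ℕ → Set where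
  before : ∀ {i} → i < m → Position m i
  at     : Position m m
  after  : ∀ j → Position m (m + suc j)

position : ∀ m i → Position m i
position zero    zero    = at
position zero    (suc j) = after j
position (suc m) zero    = before (s≤s z≤n)
position (suc m) (suc i) with position m i
... | before i<m = before (s≤s i<m)
... | at         = at
... | after j    = after j

labels : (BT → BT → ℕ) → BT → List ℕ
labels f leaf       = []
labels f (node l r) = labels f l ++ f l r ∷ labels f r

lefts rights : BT → List ℕ
lefts  = labels (λ l _ → size l)
rights = labels (λ _ r → size r)

length-labels : ∀ f T → length (labels f T) ≡ size T
length-labels f leaf       = refl
length-labels f (node l r) = begin
  length (labels f l ++ f l r ∷ labels f r)      ≡⟨ length-++ (labels f l) ⟩
  length (labels f l) + suc (length (labels f r)) ≡⟨ cong₂ (λ x y → x + suc y) (length-labels f l) (length-labels f r) ⟩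
  size l + suc (size r)                          ≡⟨ +-suc (size l) (size r) ⟩
  size (node l r)                                ∎
  where open ≡-Reasoning

map-infixStats : ∀ g T → map g (infixStats T) ≡ labels (λ l r → g (size l , size r)) T
map-infixStats g leaf       = refl
map-infixStats g (node l r) = trans (map-++ g (infixStats l) _)
  (cong₂ (λ xs ys → xs ++ g (size l , size r) ∷ ys) (map-infixStats g l) (map-infixStats g r))

nth-map : ∀ g → g (0 , 0) ≡ 0 → ∀ ps i → g (nth ps (suc i)) ≡ map g ps ! i
nth-map g g0 []       i       = g0
nth-map g g0 (p ∷ ps) zero    = refl
nth-map g g0 (p ∷ ps) (suc i) = nth-map g g0 ps i

b≡lefts : ∀ T i → b T (suc i) ≡ lefts T ! i
b≡lefts T i = trans (nth-map proj₁ refl (infixStats T) i) (cong (λ xs → xs ! i) (map-infixStats proj₁ T))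

a≡rights : ∀ T i → a T (suc i) ≡ rights T ! i
a≡rights T i = trans (nth-map proj₂ refl (infixStats T) i) (cong (λ xs → xs ! i) (map-infixStats proj₂ T))

module _ (f : BT → BT → ℕ) (l r : BT) where

  labels-node-< : ∀ {i} → i < size l → labels f (node l r) ! i ≡ labels f l ! i
  labels-node-< = !-splice-< (labels f l) (f l r) (labels f r) (length-labels f l)

  labels-node-≡ : labels f (node l r) ! size l ≡ f l r
  labels-node-≡ = !-splice-≡ (labels f l) (f l r) (labels f r) (length-labels f l)

  labels-node-> : ∀ j → labels f (node l r) ! (size l + suc j) ≡ labels f r ! j
  labels-node-> = !-splice-> (labels f l) (f l r) (labels f r) (length-labels f l)

module _ (l r : BT) where

  lefts-node-< : ∀ {i} → i < size l → lefts (node l r) ! i ≡ lefts l ! i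
  lefts-node-< = labels-node-< _ l r

  lefts-node-≡ : lefts (node l r) ! size l ≡ size l
  lefts-node-≡ = labels-node-≡ _ l r

  lefts-node-> : ∀ j → lefts (node l r) ! (size l + suc j) ≡ lefts r ! j
  lefts-node-> = labels-node-> _ l r

  rights-node-< : ∀ {i} → i < size l → rights (node l r) ! i ≡ rights l ! i
  rights-node-< = labels-node-< _ l r

  rights-node-≡ : rights (node l r) ! size l ≡ size r
  rights-node-≡ = labels-node-≡ _ l r

  rights-node-> : ∀ j → rights (node l r) ! (size l + suc j) ≡ rights r ! j
  rights-node-> = labels-node-> _ l r

j<size-right : ∀ l r j → size l + suc j < size (node l r) → j < size r
j<size-right l r j lt = +-cancelˡ-≤ (size l) (suc j) (size r) (≤-pred lt)

lefts-≤ : ∀ T i → lefts T ! i ≤ i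
lefts-≤ leaf       i = z≤n
lefts-≤ (node l r) i with position (size l) i
... | before i<l = ≤-trans (≤-reflexive (lefts-node-< l r i<l)) (lefts-≤ l i)
... | at         = ≤-reflexive (lefts-node-≡ l r)
... | after j    = ≤-trans (≤-reflexive (lefts-node-> l r j))
                     (≤-trans (lefts-≤ r j) (≤-trans (n≤1+n j) (m≤n+m (suc j) (size l))))

+rights-< : ∀ T {i} → i < size T → i + rights T ! i < size T
+rights-< leaf ()
+rights-< (node l r) {i} i<T with position (size l) i
... | before i<l = begin-strict
  i + rights (node l r) ! i ≡⟨ cong (i +_) (rights-node-< l r i<l) ⟩
  i + rights l ! i          <⟨ +rights-< l i<l ⟩
  size l                    ≤⟨ m≤m+n (size l) (size r) ⟩
  size l + size r           <⟨ n<1+n _ ⟩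
  size (node l r)           ∎
  where open ≤-Reasoning
... | at = subst (λ x → size l + x < size (node l r)) (sym (rights-node-≡ l r)) ≤-refl
... | after j = begin-strict
  size l + suc j + rights (node l r) ! (size l + suc j) ≡⟨ cong (size l + suc j +_) (rights-node-> l r j) ⟩
  size l + suc j + rights r ! j                       ≡⟨ +-assoc (size l) (suc j) _ ⟩
  size l + suc (j + rights r ! j)                     <⟨ s≤s (+-monoʳ-≤ (size l) (+rights-< r (j<size-right l r j i<T))) ⟩
  suc (size l + size r)                               ∎
  where open ≤-Reasoning

rights-last : ∀ T {i} → suc i ≡ size T → rights T ! i ≡ 0
rights-last T {i} si≡T = n≤0⇒n≡0 (+-cancelˡ-≤ i _ 0 (begin
  i + rights T ! i ≤⟨ ≤-pred (subst (i + rights T ! i <_) (sym si≡T) (+rights-< T (≤-reflexive si≡T))) ⟩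
  i                ≡⟨ +-identityʳ i ⟨
  i + 0            ∎))
  where open ≤-Reasoning

lefts-head : ∀ T → lefts T ! 0 ≡ 0
lefts-head T = n≤0⇒n≡0 (lefts-≤ T 0)

0<rights⇒lefts-suc≡0 : ∀ T {i} → 0 < rights T ! i → lefts T ! suc i ≡ 0
0<rights⇒lefts-suc≡0 leaf       ()
0<rights⇒lefts-suc≡0 (node l r) {i} a>0 with position (size l) i
... | before i<l with m≤n⇒m<n∨m≡n i<l
...   | inj₁ si<l = trans (lefts-node-< l r si<l)
                      (0<rights⇒lefts-suc≡0 l (subst (0 <_) (rights-node-< l r i<l) a>0))
...   | inj₂ si≡l = contradiction (rights-last l si≡l)
                      (>⇒≢ (subst (0 <_) (rights-node-< l r i<l) a>0))
0<rights⇒lefts-suc≡0 (node l r) a>0 | at =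
  trans (cong (lefts (node l r) !_) (+-comm 1 (size l))) (trans (lefts-node-> l r 0) (lefts-head r))
0<rights⇒lefts-suc≡0 (node l r) a>0 | after j =
  trans (cong (lefts (node l r) !_) (sym (+-suc (size l) (suc j))))
    (trans (lefts-node-> l r (suc j)) (0<rights⇒lefts-suc≡0 r (subst (0 <_) (rights-node-> l r j) a>0)))

rights≡0⇒lefts-< : ∀ T {i} → rights T ! i ≡ 0 → suc i < size T → lefts T ! i < lefts T ! suc i
rights≡0⇒lefts-< leaf _ ()
rights≡0⇒lefts-< (node l r) {i} a≡0 si<T with position (size l) i
... | before i<l with m≤n⇒m<n∨m≡n i<l
...   | inj₁ si<l = subst₂ _<_ (sym (lefts-node-< l r i<l)) (sym (lefts-node-< l r si<l))
                      (rights≡0⇒lefts-< l (trans (sym (rights-node-< l r i<l)) a≡0) si<l)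
...   | inj₂ si≡l = begin-strict
  lefts (node l r) ! i ≡⟨ lefts-node-< l r i<l ⟩
  lefts l ! i          <⟨ s≤s (lefts-≤ l i) ⟩
  suc i                ≡⟨ si≡l ⟩
  size l               ≡⟨ lefts-node-≡ l r ⟨
  lefts (node l r) ! size l ≡⟨ cong (lefts (node l r) !_) si≡l ⟨
  lefts (node l r) ! suc i  ∎
  where open ≤-Reasoning
rights≡0⇒lefts-< (node l r) a≡0 si<T | at =
  contradiction (trans (sym (rights-node-≡ l r)) a≡0)
    (>⇒≢ (+-cancelˡ-≤ (size l) 1 (size r) (subst (_≤ size l + size r) (+-comm 1 (size l)) (≤-pred si<T))))
rights≡0⇒lefts-< (node l r) a≡0 si<T | after j =
  subst₂ _<_ (sym (lefts-node-> l r j))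
    (trans (sym (lefts-node-> l r (suc j))) (cong (lefts (node l r) !_) (+-suc (size l) (suc j))))
    (rights≡0⇒lefts-< r (trans (sym (rights-node-> l r j)) a≡0)
      (j<size-right l r (suc j) (subst (_< size (node l r)) (sym (+-suc (size l) (suc j))) si<T)))

-- The subtree of the left (right) child starts (ends) where that of its parent does:
-- j ∸ b_j = i ∸ b_i, resp. k + a_k = i + a_i, stated without truncated subtraction.
left-child-aligned : ∀ T {i} → 0 < lefts T ! i → ∃[ j ] j < i × j + lefts T ! i ≡ i + lefts T ! j
left-child-aligned leaf ()
left-child-aligned (node l r) {i} b>0 with position (size l) i
... | before i<l with left-child-aligned l (subst (0 <_) (lefts-node-< l r i<l) b>0)
...   | j , j<i , eq = j , j<i , subst₂ (λ x y → j + x ≡ i + y)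
                         (sym (lefts-node-< l r i<l)) (sym (lefts-node-< l r (<-trans j<i i<l))) eq
left-child-aligned (node leaf r)         b>0 | at = contradiction (lefts-node-≡ leaf r) (>⇒≢ b>0)
left-child-aligned (node (node ll lr) r) b>0 | at = size ll , s≤s (m≤m+n (size ll) (size lr)) , (begin
  size ll + lefts (node l r) ! size l ≡⟨ cong (size ll +_) (lefts-node-≡ l r) ⟩
  size ll + size l                     ≡⟨ +-comm (size ll) (size l) ⟩
  size l + size ll                     ≡⟨ cong (size l +_) (lefts-node-≡ ll lr) ⟨
  size l + lefts l ! size ll           ≡⟨ cong (size l +_) (lefts-node-< l r (s≤s (m≤m+n (size ll) (size lr)))) ⟨
  size l + lefts (node l r) ! size ll  ∎)
  where
    l : BT
    l = node ll lr
    open ≡-Reasoning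
left-child-aligned (node l r) b>0 | after j with left-child-aligned r (subst (0 <_) (lefts-node-> l r j) b>0)
... | j' , j'<j , eq = size l + suc j' , +-monoʳ-< (size l) (s≤s j'<j) , (begin
  size l + suc j' + lefts (node l r) ! (size l + suc j) ≡⟨ cong (size l + suc j' +_) (lefts-node-> l r j) ⟩
  size l + suc j' + lefts r ! j                          ≡⟨ +-assoc (size l) (suc j') _ ⟩
  size l + suc (j' + lefts r ! j)                        ≡⟨ cong (λ x → size l + suc x) eq ⟩
  size l + suc (j + lefts r ! j')                        ≡⟨ +-assoc (size l) (suc j) _ ⟨
  size l + suc j + lefts r ! j'                          ≡⟨ cong (size l + suc j +_) (lefts-node-> l r j') ⟨
  size l + suc j + lefts (node l r) ! (size l + suc j')  ∎)
  where open ≡-Reasoning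

right-child-aligned : ∀ T {i} → 0 < rights T ! i →
                      ∃[ k ] i < k × k < size T × k + rights T ! k ≡ i + rights T ! i
right-child-aligned leaf ()
right-child-aligned (node l r) {i} a>0 with position (size l) i
... | before i<l with right-child-aligned l (subst (0 <_) (rights-node-< l r i<l) a>0)
...   | k , i<k , k<l , eq = k , i<k , ≤-trans k<l (≤-trans (m≤m+n (size l) (size r)) (n≤1+n _)) ,
          subst₂ (λ x y → k + x ≡ i + y) (sym (rights-node-< l r k<l)) (sym (rights-node-< l r i<l)) eq
right-child-aligned (node l leaf)         a>0 | at = contradiction (rights-node-≡ l leaf) (>⇒≢ a>0)
right-child-aligned (node l (node rl rr)) a>0 | at =
  k , m<m+n (size l) (s≤s z≤n) , s≤s (+-monoʳ-≤ (size l) (s≤s (m≤m+n (size rl) (size rr)))) , (begin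
  k + rights (node l r) ! k           ≡⟨ cong (k +_) (rights-node-> l r (size rl)) ⟩
  k + rights r ! size rl              ≡⟨ cong (k +_) (rights-node-≡ rl rr) ⟩
  size l + suc (size rl) + size rr    ≡⟨ +-assoc (size l) (suc (size rl)) (size rr) ⟩
  size l + size r                     ≡⟨ cong (size l +_) (rights-node-≡ l r) ⟨
  size l + rights (node l r) ! size l ∎)
  where
    r : BT
    r = node rl rr
    k : ℕ
    k = size l + suc (size rl)
    open ≡-Reasoning
right-child-aligned (node l r) a>0 | after j with right-child-aligned r (subst (0 <_) (rights-node-> l r j) a>0)
... | k , j<k , k<r , eq = size l + suc k , +-monoʳ-< (size l) (s≤s j<k) , s≤s (+-monoʳ-≤ (size l) k<r) , (begin
  size l + suc k + rights (node l r) ! (size l + suc k) ≡⟨ cong (size l + suc k +_) (rights-node-> l r k) ⟩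
  size l + suc k + rights r ! k                          ≡⟨ +-assoc (size l) (suc k) _ ⟩
  size l + suc (k + rights r ! k)                        ≡⟨ cong (λ x → size l + suc x) eq ⟩
  size l + suc (j + rights r ! j)                        ≡⟨ +-assoc (size l) (suc j) _ ⟨
  size l + suc j + rights r ! j                          ≡⟨ cong (size l + suc j +_) (rights-node-> l r j) ⟨
  size l + suc j + rights (node l r) ! (size l + suc j)  ∎)
  where open ≡-Reasoning

infix 4 _⊒_

_⊒_ : List ℕ → List ℕ → Set
xs ⊒ ys = ∀ i → ys ! i ≤ xs ! i

⊒-++ˡ : ∀ zs {xs ys} → xs ⊒ ys → zs ++ xs ⊒ zs ++ ys
⊒-++ˡ []       xs⊒ys i       = xs⊒ys i
⊒-++ˡ (z ∷ zs) xs⊒ys zero    = ≤-refl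
⊒-++ˡ (z ∷ zs) xs⊒ys (suc i) = ⊒-++ˡ zs xs⊒ys i

⊒-++ʳ : ∀ {xs ys} zs → length xs ≡ length ys → xs ⊒ ys → xs ++ zs ⊒ ys ++ zs
⊒-++ʳ {[]}     {[]}     zs _   _     i       = ≤-refl
⊒-++ʳ {x ∷ xs} {y ∷ ys} zs _   xs⊒ys zero    = xs⊒ys zero
⊒-++ʳ {x ∷ xs} {y ∷ ys} zs len xs⊒ys (suc i) = ⊒-++ʳ {xs} {ys} zs (suc-injective len) (λ i → xs⊒ys (suc i)) i

⊒-∷ : ∀ {y y'} zs → y' ≤ y → y ∷ zs ⊒ y' ∷ zs
⊒-∷ zs y'≤y zero    = y'≤y
⊒-∷ zs y'≤y (suc i) = ≤-refl

rot-size : ∀ {S S'} → Rot S S' → size S ≡ size S'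
rot-size (rotate {A} {B} {C}) = cong suc (trans (cong suc (+-assoc (size A) (size B) (size C))) (sym (+-suc (size A) _)))
rot-size (left {R = R} ρ)     = cong (λ x → suc (x + size R)) (rot-size ρ)
rot-size (right {L = L} ρ)    = cong (λ x → suc (size L + x)) (rot-size ρ)

≤T-size : ∀ {S S'} → S ≤T S' → size S ≡ size S'
≤T-size ε        = refl
≤T-size (ρ ◅ ρs) = trans (rot-size ρ) (≤T-size ρs)

lefts-rotated : ∀ A B C → lefts (node A (node B C)) ≡ lefts (node A B) ++ size B ∷ lefts C
lefts-rotated A B C = sym (++-assoc (lefts A) (size A ∷ lefts B) _)

rot-lefts-⊒ : ∀ {S S'} → Rot S S' → lefts S ⊒ lefts S'
rot-lefts-⊒ (rotate {A} {B} {C}) = subst (lefts (node (node A B) C) ⊒_) (sym (lefts-rotated A B C))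
  (⊒-++ˡ (lefts (node A B)) (⊒-∷ (lefts C) (≤-trans (m≤n+m (size B) (size A)) (n≤1+n _))))
rot-lefts-⊒ (left {L} {L'} {R} ρ) rewrite rot-size ρ =
  ⊒-++ʳ {lefts L} {lefts L'} (size L' ∷ lefts R)
    (trans (length-labels _ L) (trans (rot-size ρ) (sym (length-labels _ L')))) (rot-lefts-⊒ ρ)
rot-lefts-⊒ (right {L} ρ) = ⊒-++ˡ (lefts L) (⊒-++ˡ [ size L ] (rot-lefts-⊒ ρ))

≤T-lefts-⊒ : ∀ {S S'} → S ≤T S' → lefts S ⊒ lefts S'
≤T-lefts-⊒ ε        i = ≤-refl
≤T-lefts-⊒ (ρ ◅ ρs) i = ≤-trans (≤T-lefts-⊒ ρs i) (rot-lefts-⊒ ρ i)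

≤T-node : ∀ {L L' R R'} → L ≤T L' → R ≤T R' → node L R ≤T node L' R'
≤T-node {L' = L'} {R = R} L≤L' R≤R' = gmap (λ X → node X R) left L≤L' ◅◅ gmap (node L') right R≤R'

lefts-right-of-root : ∀ l r {i} → size l < i → lefts (node l r) ! i ≤ i ∸ suc (size l)
lefts-right-of-root l r {i} l<i with position (size l) i
... | before i<l = contradiction i<l (<⇒≯ l<i)
... | at         = contradiction l<i (<-irrefl refl)
... | after j    = subst₂ _≤_ (sym (lefts-node-> l r j)) (sym (+suc∸suc (size l) j)) (lefts-≤ r j)

-- i ∸ suc k is the largest value lefts can take at i in a tree whose root is at position k.
KeptOrMaximal : ℕ → List ℕ → List ℕ → Set
KeptOrMaximal k old new = ∀ i → old ! i ≤ new ! i ⊎ (k < i × i ∸ suc k ≤ new ! i)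

rotate-to-root : ∀ S k → k < size S → lefts S ! k ≡ k →
                 Σ BT λ A → Σ BT λ B → S ≤T node A B × size A ≡ k × KeptOrMaximal k (lefts S) (lefts (node A B))
rotate-to-root leaf k () _
rotate-to-root (node A B) k k<S root with position (size A) k
... | at = A , B , ε , refl , λ i → inj₁ ≤-refl
... | after j = contradiction root (<⇒≢ (begin-strict
  lefts (node A B) ! (size A + suc j) ≡⟨ lefts-node-> A B j ⟩
  lefts B ! j                          ≤⟨ lefts-≤ B j ⟩
  j                                    <⟨ m<n+m j (s≤s z≤n) ⟩
  suc j                                ≤⟨ m≤n+m (suc j) (size A) ⟩
  size A + suc j                       ∎))
  where open ≤-Reasoning
... | before k<A with rotate-to-root A k k<A (trans (sym (lefts-node-< A B k<A)) root)
...   | A₁ , B₁ , A≤A₁B₁ , sA₁ , kept = A₁ , node B₁ B , ≤T-node A≤A₁B₁ ε ◅◅ (rotate ◅ ε) , sA₁ ,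
                                      subst (KeptOrMaximal k (lefts (node A B))) (sym (lefts-rotated A₁ B₁ B)) kept′
  where
    len : length (lefts (node A₁ B₁)) ≡ size A
    len = trans (length-labels _ (node A₁ B₁)) (sym (≤T-size A≤A₁B₁))
    new : ℕ → ℕ
    new i = (lefts (node A₁ B₁) ++ size B₁ ∷ lefts B) ! i
    new-< : ∀ {i} → i < size A → new i ≡ lefts (node A₁ B₁) ! i
    new-< = !-splice-< (lefts (node A₁ B₁)) (size B₁) (lefts B) len
    new-≡ : new (size A) ≡ size A ∸ suc k
    new-≡ = begin
      new (size A)              ≡⟨ !-splice-≡ (lefts (node A₁ B₁)) (size B₁) (lefts B) len ⟩
      size B₁                   ≡⟨ m+n∸m≡n k (size B₁) ⟨
      suc (k + size B₁) ∸ suc k ≡⟨ cong (λ x → suc (x + size B₁) ∸ suc k) sA₁ ⟨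
      size (node A₁ B₁) ∸ suc k ≡⟨ cong (_∸ suc k) (≤T-size A≤A₁B₁) ⟨
      size A ∸ suc k            ∎
      where open ≡-Reasoning
    new-> : ∀ j → new (size A + suc j) ≡ lefts B ! j
    new-> = !-splice-> (lefts (node A₁ B₁)) (size B₁) (lefts B) len
    kept′ : KeptOrMaximal k (lefts (node A B)) (lefts (node A₁ B₁) ++ size B₁ ∷ lefts B)
    kept′ i with position (size A) i
    ... | before i<A = subst₂ (λ x y → x ≤ y ⊎ (k < i × i ∸ suc k ≤ y))
                         (sym (lefts-node-< A B i<A)) (sym (new-< i<A)) (kept i)
    ... | at         = inj₂ (k<A , ≤-reflexive (sym new-≡))
    ... | after j    = inj₁ (≤-reflexive (trans (lefts-node-> A B j) (sym (new-> j))))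

⊒-node⁻ : ∀ {A B L R} → size A ≡ size L → lefts (node A B) ⊒ lefts (node L R) →
          lefts A ⊒ lefts L × lefts B ⊒ lefts R
⊒-node⁻ {A} {B} {L} {R} sA AB⊒LR = A⊒L , B⊒R
  where
    A⊒L : lefts A ⊒ lefts L
    A⊒L i with i <? size L
    ... | yes i<L = subst₂ _≤_ (lefts-node-< L R i<L) (lefts-node-< A B (subst (i <_) (sym sA) i<L)) (AB⊒LR i)
    ... | no  i≮L = ≤-trans (≤-reflexive (!-beyond (lefts L) (subst (_≤ i) (sym (length-labels _ L)) (≮⇒≥ i≮L)))) z≤n
    B⊒R : lefts B ⊒ lefts R
    B⊒R j = subst₂ _≤_ (trans (cong (λ x → lefts (node L R) ! (x + suc j)) sA) (lefts-node-> L R j))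
                       (lefts-node-> A B j) (AB⊒LR (size A + suc j))

⊒-of-kept : ∀ {old new L R} → KeptOrMaximal (size L) old new → old ⊒ lefts (node L R) → new ⊒ lefts (node L R)
⊒-of-kept {L = L} {R} kept old⊒LR i with kept i
... | inj₁ old≤new        = ≤-trans (old⊒LR i) old≤new
... | inj₂ (L<i , max≤new) = ≤-trans (lefts-right-of-root L R L<i) max≤new

-- With k = size L', domination forces lefts S ! k ≡ k, so the k-th node of S can be rotated to
-- the root without losing domination; then both trees split at the same position.
lefts-⊒⇒≤T : ∀ S S' → size S ≡ size S' → lefts S ⊒ lefts S' → S ≤T S'
lefts-⊒⇒≤T leaf       leaf         _  _     = ε
lefts-⊒⇒≤T leaf       (node _ _)   ()  _
lefts-⊒⇒≤T (node _ _) leaf         ()  _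
lefts-⊒⇒≤T S@(node _ _) (node L' R') sS S⊒S' with rotate-to-root S (size L') L'<S root
  where
    L'<S : size L' < size S
    L'<S = subst (size L' <_) (sym sS) (s≤s (m≤m+n (size L') (size R')))
    root : lefts S ! size L' ≡ size L'
    root = ≤-antisym (lefts-≤ S (size L')) (subst (_≤ lefts S ! size L') (lefts-node-≡ L' R') (S⊒S' (size L')))
... | A , B , S≤AB , sA , kept = S≤AB ◅◅ ≤T-node (lefts-⊒⇒≤T A L' sA A⊒L') (lefts-⊒⇒≤T B R' sB B⊒R')
  where
    AB⊒S' : lefts (node A B) ⊒ lefts (node L' R')
    AB⊒S' = ⊒-of-kept {lefts S} {lefts (node A B)} {L'} {R'} kept S⊒S'
    A⊒L' : lefts A ⊒ lefts L'
    A⊒L' = proj₁ (⊒-node⁻ {A} {B} {L'} {R'} sA AB⊒S')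
    B⊒R' : lefts B ⊒ lefts R'
    B⊒R' = proj₂ (⊒-node⁻ {A} {B} {L'} {R'} sA AB⊒S')
    sB : size B ≡ size R'
    sB = +-cancelˡ-≡ (size L') _ _ (suc-injective (trans (cong (λ x → suc (x + size B)) (sym sA))
           (trans (sym (≤T-size S≤AB)) sS)))

data Consecutive {A : Set} (x y : A) : List A → Set where
  here  : ∀ {zs} → Consecutive x y (x ∷ y ∷ zs)
  there : ∀ {z zs} → Consecutive x y zs → Consecutive x y (z ∷ zs)

module _ {A : Set} {x y : A} where

  consecutive-++ : ∀ xs ys → Consecutive x y (xs ++ x ∷ y ∷ ys)
  consecutive-++ []       ys = here
  consecutive-++ (z ∷ xs) ys = there (consecutive-++ xs ys)

  consecutive⇒++ : ∀ {zs} → Consecutive x y zs → ∃[ xs ] ∃[ ys ] zs ≡ xs ++ x ∷ y ∷ ys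
  consecutive⇒++ (here {zs}) = [] , zs , refl
  consecutive⇒++ (there {z} c) with consecutive⇒++ c
  ... | xs , ys , eq = z ∷ xs , ys , cong (z ∷_) eq

  consecutive-++ˡ : ∀ {xs} ys → Consecutive x y xs → Consecutive x y (xs ++ ys)
  consecutive-++ˡ ys here      = here
  consecutive-++ˡ ys (there c) = there (consecutive-++ˡ ys c)

  consecutive-++ʳ : ∀ xs {ys} → Consecutive x y ys → Consecutive x y (xs ++ ys)
  consecutive-++ʳ []       c = c
  consecutive-++ʳ (z ∷ xs) c = there (consecutive-++ʳ xs c)

  consecutive-++⁻ : ∀ {z} xs ys → y ≢ z → Consecutive x y (xs ++ z ∷ ys) →
                    Consecutive x y xs ⊎ Consecutive x y (z ∷ ys)
  consecutive-++⁻ []           ys y≢z c         = inj₂ c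
  consecutive-++⁻ (w ∷ [])     ys y≢z here      = contradiction refl y≢z
  consecutive-++⁻ (w ∷ v ∷ xs) ys y≢z here      = inj₁ here
  consecutive-++⁻ (w ∷ xs)     ys y≢z (there c) with consecutive-++⁻ xs ys y≢z c
  ... | inj₁ c′ = inj₁ (there c′)
  ... | inj₂ c′ = inj₂ c′

  consecutive-∈ : ∀ {zs} → Consecutive x y zs → x ∈ zs × y ∈ zs
  consecutive-∈ here      = here refl , there (here refl)
  consecutive-∈ (there c) = there (proj₁ (consecutive-∈ c)) , there (proj₂ (consecutive-∈ c))

  consecutive-AllPairs : ∀ {R : A → A → Set} {zs} → AllPairs R zs → Consecutive x y zs → R x y
  consecutive-AllPairs ((Rxy All.∷ _) ∷ _) here      = Rxy
  consecutive-AllPairs (_ ∷ pairs)         (there c) = consecutive-AllPairs pairs c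

consecutive-map⁺ : ∀ {A B : Set} (f : A → B) {x y zs} → Consecutive x y zs → Consecutive (f x) (f y) (map f zs)
consecutive-map⁺ f here      = here
consecutive-map⁺ f (there c) = there (consecutive-map⁺ f c)

consecutive-map-plain⁻ : ∀ {x y} zs → Consecutive (plain x) (plain y) (map plain zs) → Consecutive x y zs
consecutive-map-plain⁻ (u ∷ v ∷ zs) here      = here
consecutive-map-plain⁻ (u ∷ zs)     (there c) = there (consecutive-map-plain⁻ zs c)

successor-exists : ∀ {A : Set} {R : A → A → Set} → Asymmetric R →
                   ∀ {zs x y} → AllPairs R zs → x ∈ zs → y ∈ zs → R x y → ∃[ z ] Consecutive x z zs
successor-exists asym (_ ∷ _)         (here refl) (here refl) Rxy = contradiction Rxy (asym Rxy)
successor-exists asym {x ∷ z ∷ _} (_ ∷ _) (here refl) (there _)   Rxy = z , here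
successor-exists asym (Rz ∷ _)        (there x∈)  (here refl) Rxy = contradiction (All.lookup Rz x∈) (asym Rxy)
successor-exists asym (_ ∷ pairs)     (there x∈)  (there y∈)  Rxy with successor-exists asym pairs x∈ y∈ Rxy
... | z , c = z , there c

budded : List ℕ → List ℕ → List HalfEdge
budded U D = bud ∷ (map plain U ++ bud ∷ map plain D)

module _ {U D : List ℕ} {x : ℕ} where

  follows-budded⁻ : ∀ {h} → Follows (budded U D) (plain x) h → IsPlain h →
                    ∃[ y ] (Consecutive x y U ⊎ Consecutive x y D)
  follows-budded⁻ (inj₂ (xs , eq)) (y , refl) with () ← ∷-injectiveˡ eq
  follows-budded⁻ (inj₁ (xs , ys , eq)) (y , refl)
    with subst (Consecutive (plain x) (plain y)) (sym eq) (consecutive-++ xs ys)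
  ... | there c with consecutive-++⁻ (map plain U) (map plain D) (λ ()) c
  ...   | inj₁ c′         = y , inj₁ (consecutive-map-plain⁻ U c′)
  ...   | inj₂ (there c′) = y , inj₂ (consecutive-map-plain⁻ D c′)

  follows-budded-upper : ∀ {y} → Consecutive x y U → Follows (budded U D) (plain x) (plain y)
  follows-budded-upper c =
    inj₁ (consecutive⇒++ (there (consecutive-++ˡ (bud ∷ map plain D) (consecutive-map⁺ plain c))))

  follows-budded-lower : ∀ {y} → Consecutive x y D → Follows (budded U D) (plain x) (plain y)
  follows-budded-lower c =
    inj₁ (consecutive⇒++ (there (consecutive-++ʳ (map plain U) (there (consecutive-map⁺ plain c)))))

RightLeftExclusive : BT → BT → Set
RightLeftExclusive T T' = ∀ i → i < size T → rights T ! i ≡ 0 ⊎ lefts T' ! i ≡ 0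

ascending-sorted : ∀ n → AllPairs _<_ (ascending n)
ascending-sorted n = AllPairs.map⁺ (AllPairs.applyUpTo⁺₁ id n (λ i<j _ → s≤s i<j))

descending-sorted : ∀ n → AllPairs _>_ (descending n)
descending-sorted n = AllPairs.map⁺ (AllPairs.applyDownFrom⁺₁ id n (λ j<i _ → s≤s j<i))

∈-ascending⁺ : ∀ {n i} → i < n → suc i ∈ ascending n
∈-ascending⁺ i<n = ∈-map⁺ suc (∈-upTo⁺ i<n)

∈-descending⁺ : ∀ {n i} → i < n → suc i ∈ descending n
∈-descending⁺ i<n = ∈-map⁺ suc (∈-downFrom⁺ i<n)

∈-ascending⁻ : ∀ {n t} → t ∈ ascending n → ∃[ i ] i < n × t ≡ suc i
∈-ascending⁻ t∈ with ∈-map⁻ suc t∈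
... | i , i∈ , refl = i , ∈-upTo⁻ i∈ , refl

∈-descending⁻ : ∀ {n t} → t ∈ descending n → ∃[ i ] i < n × t ≡ suc i
∈-descending⁻ t∈ with ∈-map⁻ suc t∈
... | i , i∈ , refl = i , ∈-downFrom⁻ i∈ , refl

upEnd-suc : ∀ T' i → upEnd T' (suc i) ≡ i ∸ lefts T' ! i
upEnd-suc T' i = cong (i ∸_) (b≡lefts T' i)

lowEnd-suc : ∀ T i → lowEnd T (suc i) ≡ suc i + rights T ! i
lowEnd-suc T i = cong (suc i +_) (a≡rights T i)

upEnd-suc-≤ : ∀ T' j → upEnd T' (suc j) ≤ j
upEnd-suc-≤ T' j = m∸n≤m j (b T' (suc j))

upEnd<lowEnd : ∀ T T' i → upEnd T' (suc i) < lowEnd T (suc i)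
upEnd<lowEnd T T' i = s≤s (≤-trans (upEnd-suc-≤ T' i) (m≤m+n i (a T (suc i))))

module _ (T T' : BT) where

  -- rotation (Φ T T') p is, by definition, budded (upper p) (lower p).
  upper lower : ℕ → List ℕ
  upper p = filter (λ t → upEnd T' t ≟ p) (descending (size T))
  lower p = filter (λ t → lowEnd T t ≟ p) (ascending (size T))

  upper-sorted : ∀ p → AllPairs _>_ (upper p)
  upper-sorted p = AllPairs.filter⁺ (λ t → upEnd T' t ≟ p) (descending-sorted (size T))

  lower-sorted : ∀ p → AllPairs _<_ (lower p)
  lower-sorted p = AllPairs.filter⁺ (λ t → lowEnd T t ≟ p) (ascending-sorted (size T))

  ∈-upper⁻ : ∀ {p t} → t ∈ upper p → (∃[ j ] t ≡ suc j) × upEnd T' t ≡ p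
  ∈-upper⁻ {p} t∈ with ∈-filter⁻ (λ t → upEnd T' t ≟ p) {xs = descending (size T)} t∈
  ... | t∈desc , up≡p with ∈-descending⁻ t∈desc
  ...   | j , _ , t≡sj = (j , t≡sj) , up≡p

  ∈-lower⁻ : ∀ {p t} → t ∈ lower p → lowEnd T t ≡ p
  ∈-lower⁻ {p} t∈ = proj₂ (∈-filter⁻ (λ t → lowEnd T t ≟ p) {xs = ascending (size T)} t∈)

  no-successor-at-upEnd : ∀ {i y} → lefts T' ! i ≡ 0 → let u = upEnd T' (suc i) in
                          ¬ (Consecutive (suc i) y (upper u) ⊎ Consecutive (suc i) y (lower u))
  no-successor-at-upEnd {i} b≡0 (inj₁ c) with ∈-upper⁻ (proj₂ (consecutive-∈ c)) | consecutive-AllPairs (upper-sorted _) c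
  ... | (j , refl) , up≡ | s≤s j<i = <-irrefl (trans up≡ (trans (upEnd-suc T' i) (cong (i ∸_) b≡0)))
                                          (≤-<-trans (upEnd-suc-≤ T' j) j<i)
  no-successor-at-upEnd {i} b≡0 (inj₂ c) =
    <-irrefl (sym (∈-lower⁻ (proj₁ (consecutive-∈ c)))) (upEnd<lowEnd T T' i)

  no-successor-at-lowEnd : ∀ {i y} → rights T ! i ≡ 0 → let v = lowEnd T (suc i) in
                           ¬ (Consecutive (suc i) y (upper v) ⊎ Consecutive (suc i) y (lower v))
  no-successor-at-lowEnd {i} a≡0 (inj₁ c) =
    <-irrefl (proj₂ (∈-upper⁻ (proj₁ (consecutive-∈ c)))) (upEnd<lowEnd T T' i)
  no-successor-at-lowEnd {i} {y} a≡0 (inj₂ c) = <-irrefl (sym low≡) (begin-strict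
    suc i + 0      ≡⟨ +-identityʳ (suc i) ⟩
    suc i          <⟨ consecutive-AllPairs (lower-sorted _) c ⟩
    y              ≤⟨ m≤m+n y (a T y) ⟩
    lowEnd T y     ∎)
    where
      open ≤-Reasoning
      low≡ : lowEnd T y ≡ suc i + 0
      low≡ = trans (∈-lower⁻ (proj₂ (consecutive-∈ c))) (trans (lowEnd-suc T i) (cong (suc i +_) a≡0))

  upper-successor : ∀ {i} → i < size T → 0 < lefts T' ! i → ∃[ y ] Consecutive (suc i) y (upper (upEnd T' (suc i)))
  upper-successor {i} i<n b>0 with left-child-aligned T' b>0
  ... | j , j<i , aligned = successor-exists <-asym (upper-sorted u)
          (∈-filter⁺ (λ t → upEnd T' t ≟ u) (∈-descending⁺ i<n) refl)
          (∈-filter⁺ (λ t → upEnd T' t ≟ u) (∈-descending⁺ (<-trans j<i i<n)) same-upEnd) (s≤s j<i)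
    where
      u : ℕ
      u = upEnd T' (suc i)
      same-upEnd : upEnd T' (suc j) ≡ u
      same-upEnd = trans (upEnd-suc T' j)
        (trans (+≡+⇒∸≡∸ j i (lefts T' ! j) (lefts T' ! i) aligned) (sym (upEnd-suc T' i)))

  lower-successor : ∀ {i} → 0 < rights T ! i → ∃[ z ] Consecutive (suc i) z (lower (lowEnd T (suc i)))
  lower-successor {i} a>0 with right-child-aligned T a>0
  ... | k , i<k , k<n , aligned = successor-exists <-asym (lower-sorted v)
          (∈-filter⁺ (λ t → lowEnd T t ≟ v) (∈-ascending⁺ (<-trans i<k k<n)) refl)
          (∈-filter⁺ (λ t → lowEnd T t ≟ v) (∈-ascending⁺ k<n) same-lowEnd) (s≤s i<k)
    where
      v : ℕ
      v = lowEnd T (suc i)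
      same-lowEnd : lowEnd T (suc k) ≡ v
      same-lowEnd = trans (lowEnd-suc T k) (trans (cong suc aligned) (sym (lowEnd-suc T i)))

exclusive⇒modern : ∀ T T' → RightLeftExclusive T T' → ModernTree (Φ T T')
exclusive⇒modern T T' excl (e , e∈ , _ , _ , F₁ , P₁ , F₂ , P₂) with ∈-ascending⁻ e∈
... | i , i<n , refl with excl i i<n
...   | inj₁ a≡0 = no-successor-at-lowEnd T T' a≡0 (proj₂ (follows-budded⁻ F₂ P₂))
...   | inj₂ b≡0 = no-successor-at-upEnd T T' b≡0 (proj₂ (follows-budded⁻ F₁ P₁))

modern⇒exclusive : ∀ T T' → ModernTree (Φ T T') → RightLeftExclusive T T'
modern⇒exclusive T T' modern i i<n with rights T ! i ≟ 0 | lefts T' ! i ≟ 0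
... | yes a≡0 | _       = inj₁ a≡0
... | no _    | yes b≡0 = inj₂ b≡0
... | no a≢0  | no b≢0  with upper-successor T T' i<n (n≢0⇒n>0 b≢0) | lower-successor T T' (n≢0⇒n>0 a≢0)
...   | y , cU | z , cL = contradiction
  (suc i , ∈-ascending⁺ i<n , plain y , plain z ,
   follows-budded-upper cU , (y , refl) , follows-budded-lower cL , (z , refl)) modern

rise-⊒⇒exclusive : ∀ T T' → lefts (node T leaf) ⊒ lefts (node leaf T') → RightLeftExclusive T T'
rise-⊒⇒exclusive T T' rise i i<n with rights T ! i ≟ 0
... | yes a≡0 = inj₁ a≡0
... | no  a≢0 = inj₂ (n≤0⇒n≡0 (begin
  lefts T' ! i                      ≤⟨ rise (suc i) ⟩
  (lefts T ++ size T ∷ []) ! suc i ≡⟨ !-splice-< (lefts T) (size T) [] (length-labels _ T) si<n ⟩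
  lefts T ! suc i                   ≡⟨ 0<rights⇒lefts-suc≡0 T (n≢0⇒n>0 a≢0) ⟩
  0                                 ∎))
  where
    open ≤-Reasoning
    si<n : suc i < size T
    si<n = ≤-<-trans (≤-trans (≤-reflexive (+-comm 1 i)) (+-monoʳ-≤ i (n≢0⇒n>0 a≢0))) (+rights-< T i<n)

exclusive⇒rise-⊒ : ∀ T T' → size T ≡ size T' → lefts T ⊒ lefts T' → RightLeftExclusive T T' →
                   lefts (node T leaf) ⊒ lefts (node leaf T')
exclusive⇒rise-⊒ T T' sT T⊒T' excl zero    = z≤n
exclusive⇒rise-⊒ T T' sT T⊒T' excl (suc i) with <-cmp (suc i) (size T)
... | tri< si<n _ _ with excl i (<-trans (n<1+n i) si<n)
...   | inj₂ b≡0 = ≤-trans (≤-reflexive b≡0) z≤n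
...   | inj₁ a≡0 = begin
  lefts T' ! i                      ≤⟨ T⊒T' i ⟩
  lefts T ! i                       <⟨ rights≡0⇒lefts-< T a≡0 si<n ⟩
  lefts T ! suc i                   ≡⟨ !-splice-< (lefts T) (size T) [] (length-labels _ T) si<n ⟨
  (lefts T ++ size T ∷ []) ! suc i ∎
  where open ≤-Reasoning
exclusive⇒rise-⊒ T T' sT T⊒T' excl (suc i) | tri≈ _ si≡n _ = begin
  lefts T' ! i                      ≤⟨ lefts-≤ T' i ⟩
  i                                 <⟨ n<1+n i ⟩
  suc i                             ≡⟨ si≡n ⟩
  size T                            ≡⟨ !-splice-≡ (lefts T) (size T) [] (length-labels _ T) ⟨
  (lefts T ++ size T ∷ []) ! size T ≡⟨ cong ((lefts T ++ size T ∷ []) !_) si≡n ⟨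
  (lefts T ++ size T ∷ []) ! suc i ∎
  where open ≤-Reasoning
exclusive⇒rise-⊒ T T' sT T⊒T' excl (suc i) | tri> _ _ n<si =
  ≤-trans (≤-reflexive (!-beyond (lefts T') (subst (_≤ i) (trans sT (sym (length-labels _ T'))) (≤-pred n<si)))) z≤n

modern-interval⇔exclusive : ∀ {T T'} → T ≤T T' → ModernInterval T T' ⇔ RightLeftExclusive T T'
modern-interval⇔exclusive {T} {T'} T≤T' = mk⇔
  (λ rise → rise-⊒⇒exclusive T T' (≤T-lefts-⊒ rise))
  (λ excl → lefts-⊒⇒≤T (node T leaf) (node leaf T') rise-size
              (exclusive⇒rise-⊒ T T' (≤T-size T≤T') (≤T-lefts-⊒ T≤T') excl))
  where
    rise-size : size (node T leaf) ≡ size (node leaf T')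
    rise-size = cong suc (trans (+-identityʳ (size T)) (≤T-size T≤T'))

modern-tree⇔exclusive : ∀ T T' → ModernTree (Φ T T') ⇔ RightLeftExclusive T T'
modern-tree⇔exclusive T T' = mk⇔ (modern⇒exclusive T T') (exclusive⇒modern T T')

lemma4p9 : (T T' : BT) → T ≤T T' → (ModernInterval T T' ⇔ ModernTree (Φ T T'))
lemma4p9 T T' T≤T' = ⇔.trans (modern-interval⇔exclusive T≤T') (⇔.sym (modern-tree⇔exclusive T T'))
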